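{- For every $n\ge-1$, $\mathrm{cil}_2\,\gamma_+[n]=|\mathrm{Cil}_2\Gamma_+[n]|$; equivalently, $\mathrm{cil}_2=|\mathrm{Cil}_2|$.
   Context: Sequences indexed by $\mathbb{N}_+=\{ -1,0,1,\dots\}$; convention $\binom{p}{q}=0$ if $p<q$ or $q<0$. Define $\breve{\mathrm{cil}}_2\,\gamma_+[j]_m=\sum_{i=-1}^{j}\binom{j+1}{i+1}\binom{i+1}{m-j}$ and $\mathrm{cil}_2\,\gamma_+[n]=\sum_{j=-1}^{n}\binom{1+n}{1+j}\breve{\mathrm{cil}}_2\,\gamma_+[j]$, and let $\mathrm{cil}_2$ be the matrix with $(n,m)$ entry $\mathrm{cil}_2\,\gamma_+[n]_m$. Geometric side: $[n]=\{0<\dots<n\}$ ($n\ge0$), $[-1]=\emptyset$; $\Gamma_+[n]_p$ = strictly increasing maps $[p]\to[n]$. $\mathrm{Cil}_2\Gamma_+[n]=\Gamma_+[n]\boxplus\Gamma_+[n]$, whose $m$-simplices are all pairs $(\sigma,\tau)\in\Gamma_+[n]_p\times\Gamma_+[n]_q$ with $p,q\ge-1$, $p+q=m-1$. $|\mathrm{Cil}_2|$ is the matrix with $(n,m)$ entry $|\mathrm{Cil}_2\Gamma_+[n]_m|$. -}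

module Defs where

open import Data.Nat using (ℕ; zero; suc; _+_; _*_; _∸_; _≤ᵇ_)
open import Data.Nat.Combinatorics using (_C_)
open import Data.Bool using (if_then_else_)
open import Data.Fin using (Fin; _<_)
open import Data.Vec using (Vec; toList)
open import Data.List.Relation.Unary.Linked using (Linked)
open import Data.Product using (Σ; _×_)
open import Relation.Binary.PropositionalEquality using (_≡_)

-- CONVENTION: an index k ∈ ℕ₊ = {-1,0,1,...} is represented by the natural
-- number K = k + 1.  So N = n+1, M = m+1, J = j+1, I = i+1, P = p+1, Q = q+1.

sumTo : ℕ → (ℕ → ℕ) → ℕ
sumTo zero    f = f zero
sumTo (suc K) f = sumTo K f + f (suc K)

-- binomial with the convention (p choose q) = 0 if q < 0 : here q = M - J
-- is negative exactly when M < J.  stdlib's _C_ already gives 0 if p < q.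
-- chooseDiff I M J = binom(I, M - J)
chooseDiff : ℕ → ℕ → ℕ → ℕ
chooseDiff I M J = if J ≤ᵇ M then I C (M ∸ J) else 0

-- breve cil_2 γ_+[j]_m = Σ_{i=-1}^{j} C(j+1,i+1) C(i+1,m-j)
-- with J = j+1, M = m+1, I = i+1 (so m - j = M - J).
cilBreve : ℕ → ℕ → ℕ
cilBreve J M = sumTo J (λ I → (J C I) * chooseDiff I M J)

-- cil_2 γ_+[n]_m = Σ_{j=-1}^{n} C(1+n,1+j) · breve cil_2 γ_+[j]_m
-- the (n,m) entry of the matrix cil_2, with N = n+1, M = m+1.
cil2 : ℕ → ℕ → ℕ
cil2 N M = sumTo N (λ J → (N C J) * cilBreve J M)

-- Γ_+[n]_p : strictly increasing maps [p] → [n], where [n] has n+1 = N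
-- elements and [p] has p+1 = P elements ([-1] = ∅).
Gamma+ : ℕ → ℕ → Set
Gamma+ N P = Σ (Vec (Fin N) P) (λ σ → Linked _<_ (toList σ))

-- m-simplices of Cil_2 Γ_+[n] = Γ_+[n] ⊞ Γ_+[n]: pairs (σ,τ) ∈ Γ_+[n]_p × Γ_+[n]_q
-- with p,q ≥ -1 and p + q = m - 1, i.e. P + Q = M (P = p+1, Q = q+1, M = m+1).
Cil2Simplices : ℕ → ℕ → Set
Cil2Simplices N M =
  Σ ℕ (λ P → Σ ℕ (λ Q → (P + Q ≡ M) × (Gamma+ N P × Gamma+ N Q)))

-- Read every count as a coefficient sequence ℕ → ℕ in a variable x, indexed by
-- M = m + 1.  Splitting Γ₊[n]_p by whether 0 is hit gives Pascal's rule, so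
-- |Γ₊[n]_p| = C(n+1, p+1) and the m-simplices of Cil₂Γ₊[n] are counted by the
-- Cauchy square of the binomial row (1 + x)^(n+1).  On the other side
-- breve-cil₂ γ₊[j] = x^(j+1) Σᵢ C(j+1, i+1) (1 + x)^(i+1) = (x(2 + x))^(j+1), so its
-- binomial transform cil₂ γ₊[n] is (1 + x(2 + x))^(n+1).  Both sides are therefore
-- (1 + x)^(2(n+1)); this is proved as the common recurrence "multiply by (1 + x)²
-- when n increases" from the common value 1 at n = -1.
module Submission where

open import Defs
open import Data.Nat using (ℕ; zero; suc; _+_; _*_; _∸_; _≤ᵇ_; z≤n; s≤s; s≤s⁻¹; z<s)
open import Data.Nat.Properties
  using (+-assoc; +-comm; +-identityʳ; *-identityˡ; *-zeroʳ; *-distribˡ-+; *-distribʳ-+;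
         +-commutativeSemigroup; n<1+n; suc-injective; ≡-irrelevant)
open import Data.Nat.Combinatorics using (_C_; nCk+nC[k+1]≡[n+1]C[k+1])
open import Data.Nat.Combinatorics.Specification using (k>n⇒nCk≡0)
open import Data.Bool using (if_then_else_)
open import Data.Fin using (Fin; zero; suc; _<_)
open import Data.Fin.Properties using (+↔⊎; *↔×; <-irrelevant)
open import Data.Vec using (Vec; []; _∷_; toList; map)
open import Data.List using (List; _∷_)
open import Data.List.Relation.Unary.Linked as Linked using (Linked; []; [-]; _∷_)
open import Data.Product using (Σ; _×_; _,_)
open import Data.Sum using (_⊎_; inj₁; inj₂)
open import Data.Sum.Function.Propositional using (_⊎-↔_)
open import Data.Product.Function.NonDependent.Propositional using (_×-↔_)
open import Function using (_∘_)
open import Function.Bundles using (_↔_; mk↔ₛ′)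
open import Function.Properties.Inverse using (↔-trans; ↔-sym)
open import Algebra.Properties.CommutativeSemigroup +-commutativeSemigroup using (interchange)
open import Relation.Binary.PropositionalEquality
import Relation.Binary.Reasoning.Setoid as SetoidReasoning

module ≗-Reasoning = SetoidReasoning (ℕ →-setoid ℕ)

infixl 6 _⊕_
infixr 7 _∗_
infixr 8 x*_ [1+x]*_ [2+x]*_ x^_*_

_⊕_ : (ℕ → ℕ) → (ℕ → ℕ) → ℕ → ℕ
(f ⊕ g) k = f k + g k

x*_ : (ℕ → ℕ) → ℕ → ℕ
(x* f) zero    = 0
(x* f) (suc k) = f k

x^_*_ : ℕ → (ℕ → ℕ) → ℕ → ℕ
x^ zero  * f = f
x^ suc J * f = x* x^ J * f

[1+x]*_ : (ℕ → ℕ) → ℕ → ℕ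
[1+x]* f = f ⊕ x* f

[2+x]*_ : (ℕ → ℕ) → ℕ → ℕ
[2+x]* f = f ⊕ [1+x]* f

⊕-cong : ∀ {f f′ g g′} → f ≗ f′ → g ≗ g′ → f ⊕ g ≗ f′ ⊕ g′
⊕-cong f≗f′ g≗g′ k = cong₂ _+_ (f≗f′ k) (g≗g′ k)

⊕-congˡ : ∀ f {g g′} → g ≗ g′ → f ⊕ g ≗ f ⊕ g′
⊕-congˡ f g≗g′ k = cong (f k +_) (g≗g′ k)

x*-cong : ∀ {f g} → f ≗ g → x* f ≗ x* g
x*-cong f≗g zero    = refl
x*-cong f≗g (suc k) = f≗g k

x^-cong : ∀ J {f g} → f ≗ g → x^ J * f ≗ x^ J * g
x^-cong zero    f≗g = f≗g
x^-cong (suc J) f≗g = x*-cong (x^-cong J f≗g)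

[1+x]*-cong : ∀ {f g} → f ≗ g → [1+x]* f ≗ [1+x]* g
[1+x]*-cong f≗g = ⊕-cong f≗g (x*-cong f≗g)

[2+x]*-cong : ∀ {f g} → f ≗ g → [2+x]* f ≗ [2+x]* g
[2+x]*-cong f≗g = ⊕-cong f≗g ([1+x]*-cong f≗g)

x*-[2+x]* : ∀ f → x* [2+x]* f ≗ [2+x]* x* f
x*-[2+x]* f zero    = refl
x*-[2+x]* f (suc k) = refl

x^-[2+x]* : ∀ J f → x^ J * [2+x]* f ≗ [2+x]* x^ J * f
x^-[2+x]* zero    f k = refl
x^-[2+x]* (suc J) f k = trans (x*-cong (x^-[2+x]* J f) k) (x*-[2+x]* (x^ J * f) k)

[1+x]²-expand : ∀ f → [1+x]* [1+x]* f ≗ f ⊕ x* [2+x]* f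
[1+x]²-expand f zero    = +-identityʳ (f 0 + 0)
[1+x]²-expand f (suc k) = +-assoc (f (suc k)) (f k) _

x^*-apply : ∀ J h M → (x^ J * h) M ≡ (if J ≤ᵇ M then h (M ∸ J) else 0)
x^*-apply zero          h M       = refl
x^*-apply (suc J)       h zero    = refl
x^*-apply (suc zero)    h (suc M) = refl
x^*-apply (suc (suc J)) h (suc M) = x^*-apply (suc J) h M

C-suc : ∀ N → (suc N C_) ≗ [1+x]* (N C_)
C-suc N zero    = refl
C-suc N (suc P) = trans (sym (nCk+nC[k+1]≡[n+1]C[k+1] N P)) (+-comm (N C P) _)

sumTo-cong : ∀ K {f g} → f ≗ g → sumTo K f ≡ sumTo K g
sumTo-cong zero    f≗g = f≗g 0
sumTo-cong (suc K) f≗g = cong₂ _+_ (sumTo-cong K f≗g) (f≗g (suc K))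

sumTo-zero : ∀ K → sumTo K (λ _ → 0) ≡ 0
sumTo-zero zero    = refl
sumTo-zero (suc K) = trans (+-identityʳ _) (sumTo-zero K)

sumTo-+ : ∀ K f g → sumTo K (f ⊕ g) ≡ sumTo K f + sumTo K g
sumTo-+ zero    f g = refl
sumTo-+ (suc K) f g =
  trans (cong (_+ (f (suc K) + g (suc K))) (sumTo-+ K f g))
        (interchange (sumTo K f) (sumTo K g) (f (suc K)) (g (suc K)))

sumTo-head : ∀ K f → sumTo (suc K) f ≡ f 0 + sumTo K (f ∘ suc)
sumTo-head zero    f = refl
sumTo-head (suc K) f =
  trans (cong (_+ f (suc (suc K))) (sumTo-head K f)) (+-assoc (f 0) _ _)

binomialTransform : ℕ → (ℕ → ℕ → ℕ) → ℕ → ℕ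
binomialTransform N f M = sumTo N (λ J → (N C J) * f J M)

binomialTransform-cong : ∀ N {f g} → (∀ J → f J ≗ g J) →
  binomialTransform N f ≗ binomialTransform N g
binomialTransform-cong N f≗g M = sumTo-cong N (λ J → cong ((N C J) *_) (f≗g J M))

binomialTransform-suc : ∀ N f →
  binomialTransform (suc N) f ≗ binomialTransform N f ⊕ binomialTransform N (f ∘ suc)
binomialTransform-suc N f M = begin
  sumTo (suc N) (λ J → (suc N C J) * f J M)
    ≡⟨ sumTo-cong (suc N) pascalTerm ⟩
  sumTo (suc N) ((λ J → (N C J) * f J M) ⊕ (λ J → (x* (N C_)) J * f J M))
    ≡⟨ sumTo-+ (suc N) _ _ ⟩
  sumTo (suc N) (λ J → (N C J) * f J M) + sumTo (suc N) (λ J → (x* (N C_)) J * f J M)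
    ≡⟨ cong₂ _+_ lastTermVanishes (sumTo-head N _) ⟩
  binomialTransform N f M + binomialTransform N (f ∘ suc) M ∎
  where
  pascalTerm : ∀ J → (suc N C J) * f J M ≡ (N C J) * f J M + (x* (N C_)) J * f J M
  pascalTerm J = trans (cong (_* f J M) (C-suc N J)) (*-distribʳ-+ (f J M) (N C J) _)
  lastTermVanishes : sumTo (suc N) (λ J → (N C J) * f J M) ≡ binomialTransform N f M
  lastTermVanishes =
    trans (cong (λ c → binomialTransform N f M + c * f (suc N) M) (k>n⇒nCk≡0 (n<1+n N)))
          (+-identityʳ _)
  open ≡-Reasoning

binomialTransform-⊕ : ∀ N f g →
  binomialTransform N (λ J → f J ⊕ g J) ≗ binomialTransform N f ⊕ binomialTransform N g
binomialTransform-⊕ N f g M =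
  trans (sumTo-cong N (λ J → *-distribˡ-+ (N C J) (f J M) (g J M))) (sumTo-+ N _ _)

binomialTransform-x* : ∀ N f → binomialTransform N (λ J → x* f J) ≗ x* binomialTransform N f
binomialTransform-x* N f zero    = trans (sumTo-cong N (λ J → *-zeroʳ (N C J))) (sumTo-zero N)
binomialTransform-x* N f (suc M) = refl

binomialTransform-x^ : ∀ N K f →
  binomialTransform N (λ J → x^ K * f J) ≗ x^ K * binomialTransform N f
binomialTransform-x^ N zero    f M = refl
binomialTransform-x^ N (suc K) f M =
  trans (binomialTransform-x* N (λ J → x^ K * f J) M) (x*-cong (binomialTransform-x^ N K f) M)

binomialTransform-[1+x]* : ∀ N f →
  binomialTransform N (λ J → [1+x]* f J) ≗ [1+x]* binomialTransform N f
binomialTransform-[1+x]* N f M =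
  trans (binomialTransform-⊕ N f (λ J → x* f J) M)
        (⊕-congˡ (binomialTransform N f) (binomialTransform-x* N f) M)

binomialTransform-[2+x]* : ∀ N f →
  binomialTransform N (λ J → [2+x]* f J) ≗ [2+x]* binomialTransform N f
binomialTransform-[2+x]* N f M =
  trans (binomialTransform-⊕ N f (λ J → [1+x]* f J) M)
        (⊕-congˡ (binomialTransform N f) (binomialTransform-[1+x]* N f) M)

innerSum : ℕ → ℕ → ℕ
innerSum J = binomialTransform J _C_

innerSum-suc : ∀ J → innerSum (suc J) ≗ [2+x]* innerSum J
innerSum-suc J = begin
  innerSum (suc J)
    ≈⟨ binomialTransform-suc J _C_ ⟩
  innerSum J ⊕ binomialTransform J (λ I → suc I C_)
    ≈⟨ ⊕-congˡ (innerSum J) (binomialTransform-cong J C-suc) ⟩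
  innerSum J ⊕ binomialTransform J (λ I → [1+x]* (I C_))
    ≈⟨ ⊕-congˡ (innerSum J) (binomialTransform-[1+x]* J _C_) ⟩
  [2+x]* innerSum J ∎
  where open ≗-Reasoning

cilBreve≗x^*innerSum : ∀ J → cilBreve J ≗ x^ J * innerSum J
cilBreve≗x^*innerSum J M =
  trans (sumTo-cong J (λ I → cong ((J C I) *_) (sym (x^*-apply J (I C_) M))))
        (binomialTransform-x^ J J _C_ M)

cilBreve-suc : ∀ J → cilBreve (suc J) ≗ x* [2+x]* cilBreve J
cilBreve-suc J = begin
  cilBreve (suc J)             ≈⟨ cilBreve≗x^*innerSum (suc J) ⟩
  x* x^ J * innerSum (suc J)   ≈⟨ x*-cong (x^-cong J (innerSum-suc J)) ⟩
  x* x^ J * [2+x]* innerSum J  ≈⟨ x*-cong (x^-[2+x]* J (innerSum J)) ⟩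
  x* [2+x]* x^ J * innerSum J  ≈⟨ x*-cong ([2+x]*-cong (sym ∘ cilBreve≗x^*innerSum J)) ⟩
  x* [2+x]* cilBreve J         ∎
  where open ≗-Reasoning

cil2-zero : cil2 0 ≗ (0 C_)
cil2-zero M = trans (*-identityˡ _) (*-identityˡ _)

cil2-suc : ∀ N → cil2 (suc N) ≗ [1+x]* [1+x]* cil2 N
cil2-suc N = begin
  cil2 (suc N)
    ≈⟨ binomialTransform-suc N cilBreve ⟩
  cil2 N ⊕ binomialTransform N (cilBreve ∘ suc)
    ≈⟨ ⊕-congˡ (cil2 N) (binomialTransform-cong N cilBreve-suc) ⟩
  cil2 N ⊕ binomialTransform N (λ J → x* [2+x]* cilBreve J)
    ≈⟨ ⊕-congˡ (cil2 N) (binomialTransform-x* N _) ⟩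
  cil2 N ⊕ x* binomialTransform N (λ J → [2+x]* cilBreve J)
    ≈⟨ ⊕-congˡ (cil2 N) (x*-cong (binomialTransform-[2+x]* N cilBreve)) ⟩
  cil2 N ⊕ x* [2+x]* cil2 N
    ≈⟨ [1+x]²-expand (cil2 N) ⟨
  [1+x]* [1+x]* cil2 N ∎
  where open ≗-Reasoning

antidiagonalSum : ℕ → (ℕ → ℕ → ℕ) → ℕ
antidiagonalSum zero    y = y 0 0
antidiagonalSum (suc M) y = y 0 (suc M) + antidiagonalSum M (λ P Q → y (suc P) Q)

antidiagonalSum-cong : ∀ M {y z} → (∀ P Q → y P Q ≡ z P Q) →
  antidiagonalSum M y ≡ antidiagonalSum M z
antidiagonalSum-cong zero    y≡z = y≡z 0 0
antidiagonalSum-cong (suc M) y≡z =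
  cong₂ _+_ (y≡z 0 (suc M)) (antidiagonalSum-cong M (λ P → y≡z (suc P)))

antidiagonalSum-zero : ∀ M → antidiagonalSum M (λ _ _ → 0) ≡ 0
antidiagonalSum-zero zero    = refl
antidiagonalSum-zero (suc M) = antidiagonalSum-zero M

antidiagonalSum-+ : ∀ M y z →
  antidiagonalSum M (λ P Q → y P Q + z P Q) ≡ antidiagonalSum M y + antidiagonalSum M z
antidiagonalSum-+ zero    y z = refl
antidiagonalSum-+ (suc M) y z =
  trans (cong (y 0 (suc M) + z 0 (suc M) +_) (antidiagonalSum-+ M _ _))
        (interchange (y 0 (suc M)) (z 0 (suc M)) _ _)

_∗_ : (ℕ → ℕ) → (ℕ → ℕ) → ℕ → ℕ
(f ∗ g) M = antidiagonalSum M (λ P Q → f P * g Q)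

∗-cong : ∀ {f f′ g g′} → f ≗ f′ → g ≗ g′ → f ∗ g ≗ f′ ∗ g′
∗-cong f≗f′ g≗g′ M = antidiagonalSum-cong M (λ P Q → cong₂ _*_ (f≗f′ P) (g≗g′ Q))

∗-identityˡ : ∀ g → (0 C_) ∗ g ≗ g
∗-identityˡ g zero    = *-identityˡ (g 0)
∗-identityˡ g (suc M) = trans (cong₂ _+_ (*-identityˡ (g (suc M))) restVanishes) (+-identityʳ _)
  where
  restVanishes : antidiagonalSum M (λ P Q → (0 C suc P) * g Q) ≡ 0
  restVanishes =
    trans (antidiagonalSum-cong M (λ P Q → cong (_* g Q) (k>n⇒nCk≡0 {0} {suc P} z<s)))
          (antidiagonalSum-zero M)

∗-⊕ˡ : ∀ f f′ g → (f ⊕ f′) ∗ g ≗ f ∗ g ⊕ f′ ∗ g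
∗-⊕ˡ f f′ g M =
  trans (antidiagonalSum-cong M (λ P Q → *-distribʳ-+ (g Q) (f P) (f′ P)))
        (antidiagonalSum-+ M _ _)

∗-⊕ʳ : ∀ f g g′ → f ∗ (g ⊕ g′) ≗ f ∗ g ⊕ f ∗ g′
∗-⊕ʳ f g g′ M =
  trans (antidiagonalSum-cong M (λ P Q → *-distribˡ-+ (f P) (g Q) (g′ Q)))
        (antidiagonalSum-+ M _ _)

∗-x*ˡ : ∀ f g → (x* f) ∗ g ≗ x* (f ∗ g)
∗-x*ˡ f g zero    = refl
∗-x*ˡ f g (suc M) = refl

∗-x*ʳ : ∀ f g → f ∗ (x* g) ≗ x* (f ∗ g)
∗-x*ʳ f g zero    = *-zeroʳ (f 0)
∗-x*ʳ f g (suc M) = trans (cong (f 0 * g M +_) (∗-x*ʳ (f ∘ suc) g M)) (peel M)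
  where
  peel : ∀ M → f 0 * g M + (x* ((f ∘ suc) ∗ g)) M ≡ (f ∗ g) M
  peel zero    = +-identityʳ (f 0 * g 0)
  peel (suc M) = refl

∗-[1+x]*ˡ : ∀ f g → ([1+x]* f) ∗ g ≗ [1+x]* (f ∗ g)
∗-[1+x]*ˡ f g M = trans (∗-⊕ˡ f (x* f) g M) (cong ((f ∗ g) M +_) (∗-x*ˡ f g M))

∗-[1+x]*ʳ : ∀ f g → f ∗ ([1+x]* g) ≗ [1+x]* (f ∗ g)
∗-[1+x]*ʳ f g M = trans (∗-⊕ʳ f g (x* g) M) (cong ((f ∗ g) M +_) (∗-x*ʳ f g M))

C∗C-suc : ∀ N → (suc N C_) ∗ (suc N C_) ≗ [1+x]* [1+x]* ((N C_) ∗ (N C_))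
C∗C-suc N = begin
  (suc N C_) ∗ (suc N C_)            ≈⟨ ∗-cong (C-suc N) (C-suc N) ⟩
  ([1+x]* (N C_)) ∗ ([1+x]* (N C_))  ≈⟨ ∗-[1+x]*ˡ (N C_) _ ⟩
  [1+x]* ((N C_) ∗ [1+x]* (N C_))    ≈⟨ [1+x]*-cong (∗-[1+x]*ʳ (N C_) (N C_)) ⟩
  [1+x]* [1+x]* ((N C_) ∗ (N C_))    ∎
  where open ≗-Reasoning

cil2≗C∗C : ∀ N → cil2 N ≗ (N C_) ∗ (N C_)
cil2≗C∗C zero    M = trans (cil2-zero M) (sym (∗-identityˡ (0 C_) M))
cil2≗C∗C (suc N) M = begin
  cil2 (suc N) M                          ≡⟨ cil2-suc N M ⟩
  ([1+x]* [1+x]* cil2 N) M                ≡⟨ [1+x]*-cong ([1+x]*-cong (cil2≗C∗C N)) M ⟩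
  ([1+x]* [1+x]* ((N C_) ∗ (N C_))) M     ≡⟨ C∗C-suc N M ⟨
  ((suc N C_) ∗ (suc N C_)) M             ∎
  where open ≡-Reasoning

Antidiagonal : ℕ → (ℕ → ℕ → Set) → Set
Antidiagonal M Y = Σ ℕ (λ P → Σ ℕ (λ Q → (P + Q ≡ M) × Y P Q))

antidiagonal↔ : ∀ M (Y : ℕ → ℕ → Set) (y : ℕ → ℕ → ℕ) →
  (∀ P Q → Y P Q ↔ Fin (y P Q)) → Antidiagonal M Y ↔ Fin (antidiagonalSum M y)
antidiagonal↔ zero    Y y Y↔y = ↔-trans diagonal↔origin (Y↔y 0 0)
  where
  diagonal↔origin : Antidiagonal 0 Y ↔ Y 0 0
  diagonal↔origin = mk↔ₛ′ (λ { (zero , zero , refl , a) → a }) (λ a → 0 , 0 , refl , a)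
                          (λ _ → refl) (λ { (zero , zero , refl , a) → refl })
antidiagonal↔ (suc M) Y y Y↔y =
  ↔-trans splitFirst
    (↔-trans (Y↔y 0 (suc M) ⊎-↔ antidiagonal↔ M (Y ∘ suc) (y ∘ suc) (Y↔y ∘ suc)) (↔-sym +↔⊎))
  where
  splitFirst : Antidiagonal (suc M) Y ↔ (Y 0 (suc M) ⊎ Antidiagonal M (λ P → Y (suc P)))
  splitFirst = mk↔ₛ′ to from to∘from from∘to
    where
    to : Antidiagonal (suc M) Y → Y 0 (suc M) ⊎ Antidiagonal M (λ P → Y (suc P))
    to (zero  , _ , refl , a) = inj₁ a
    to (suc P , Q , e    , a) = inj₂ (P , Q , suc-injective e , a)
    from : Y 0 (suc M) ⊎ Antidiagonal M (λ P → Y (suc P)) → Antidiagonal (suc M) Y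
    from (inj₁ a)               = 0 , suc M , refl , a
    from (inj₂ (P , Q , e , a)) = suc P , Q , cong suc e , a
    to∘from : ∀ z → to (from z) ≡ z
    to∘from (inj₁ a)               = refl
    to∘from (inj₂ (P , Q , e , a)) = cong (λ e′ → inj₂ (P , Q , e′ , a)) (≡-irrelevant _ _)
    from∘to : ∀ z → from (to z) ≡ z
    from∘to (zero  , _ , refl , a) = refl
    from∘to (suc P , Q , e    , a) = cong (λ e′ → suc P , Q , e′ , a) (≡-irrelevant _ _)

Σ-Linked-≡ : ∀ {A : Set} {n} {xs : A → List (Fin n)} {a a′ : A}
  {l : Linked _<_ (xs a)} {l′ : Linked _<_ (xs a′)} →
  a ≡ a′ → _≡_ {A = Σ A (λ a → Linked _<_ (xs a))} (a , l) (a′ , l′)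
Σ-Linked-≡ {l = l} {l′} refl = cong (_ ,_) (Linked.irrelevant <-irrelevant l l′)

-- Strictly increasing sequences in [n] that avoid 0, encoded by requiring that
-- they stay strictly increasing after prepending 0.
Gamma+⁺ : ℕ → ℕ → Set
Gamma+⁺ N P = Σ (Vec (Fin (suc N)) P) (λ σ → Linked _<_ (zero ∷ toList σ))

module _ {N : ℕ} where

  -- Subtracts 1 from every entry; the entry c preceding σ shows that they are positive.
  lower : ∀ {P} (c : Fin (suc N)) (σ : Vec (Fin (suc N)) P) →
    Linked _<_ (c ∷ toList σ) → Vec (Fin N) P
  lower c []          _         = []
  lower c (zero  ∷ σ) (() ∷ _)
  lower c (suc i ∷ σ) (_ ∷ σ↑) = i ∷ lower (suc i) σ σ↑

  lower-linked : ∀ {P} (i : Fin N) (σ : Vec (Fin (suc N)) P)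
    (σ↑ : Linked _<_ (suc i ∷ toList σ)) → Linked _<_ (i ∷ toList (lower (suc i) σ σ↑))
  lower-linked i []          [-]           = [-]
  lower-linked i (zero  ∷ σ) (() ∷ _)
  lower-linked i (suc j ∷ σ) (i<j ∷ σ↑) = s≤s⁻¹ i<j ∷ lower-linked j σ σ↑

  lower-linked₀ : ∀ {P} (c : Fin (suc N)) (σ : Vec (Fin (suc N)) P)
    (σ↑ : Linked _<_ (c ∷ toList σ)) → Linked _<_ (toList (lower c σ σ↑))
  lower-linked₀ c []          _         = []
  lower-linked₀ c (zero  ∷ σ) (() ∷ _)
  lower-linked₀ c (suc i ∷ σ) (_ ∷ σ↑) = lower-linked i σ σ↑

  lift-linked : ∀ {P} (i : Fin N) (τ : Vec (Fin N) P) → Linked _<_ (i ∷ toList τ) →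
    Linked _<_ (suc i ∷ toList (map suc τ))
  lift-linked i []      [-]        = [-]
  lift-linked i (j ∷ τ) (i<j ∷ τ↑) = s≤s i<j ∷ lift-linked j τ τ↑

  lift-linked₀ : ∀ {P} (τ : Vec (Fin N) P) → Linked _<_ (toList τ) →
    Linked _<_ (zero ∷ toList (map suc τ))
  lift-linked₀ []      []  = [-]
  lift-linked₀ (i ∷ τ) τ↑ = s≤s z≤n ∷ lift-linked i τ τ↑

  lower-map-suc : ∀ {P} (c : Fin (suc N)) (τ : Vec (Fin N) P) σ↑ →
    lower c (map suc τ) σ↑ ≡ τ
  lower-map-suc c []      _        = refl
  lower-map-suc c (i ∷ τ) (_ ∷ σ↑) = cong (i ∷_) (lower-map-suc (suc i) τ σ↑)

  map-suc-lower : ∀ {P} (c : Fin (suc N)) (σ : Vec (Fin (suc N)) P) σ↑ →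
    map suc (lower c σ σ↑) ≡ σ
  map-suc-lower c []          _         = refl
  map-suc-lower c (zero  ∷ σ) (() ∷ _)
  map-suc-lower c (suc i ∷ σ) (_ ∷ σ↑) = cong (suc i ∷_) (map-suc-lower (suc i) σ σ↑)

Gamma+⁺↔Gamma+ : ∀ N P → Gamma+⁺ N P ↔ Gamma+ N P
Gamma+⁺↔Gamma+ N P = mk↔ₛ′ to from to∘from from∘to
  where
  to : Gamma+⁺ N P → Gamma+ N P
  to (σ , σ↑) = lower zero σ σ↑ , lower-linked₀ zero σ σ↑
  from : Gamma+ N P → Gamma+⁺ N P
  from (τ , τ↑) = map suc τ , lift-linked₀ τ τ↑
  to∘from : ∀ τ → to (from τ) ≡ τ
  to∘from (τ , τ↑) = Σ-Linked-≡ (lower-map-suc zero τ (lift-linked₀ τ τ↑))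
  from∘to : ∀ σ → from (to σ) ≡ σ
  from∘to (σ , σ↑) = Σ-Linked-≡ (map-suc-lower zero σ σ↑)

Gamma+-splitByHead : ∀ N P → Gamma+ (suc N) (suc P) ↔ (Gamma+⁺ N P ⊎ Gamma+⁺ N (suc P))
Gamma+-splitByHead N P = mk↔ₛ′ to from to∘from from∘to
  where
  to : Gamma+ (suc N) (suc P) → Gamma+⁺ N P ⊎ Gamma+⁺ N (suc P)
  to (zero  ∷ σ , σ↑) = inj₁ (σ , σ↑)
  to (suc i ∷ σ , σ↑) = inj₂ (suc i ∷ σ , s≤s z≤n ∷ σ↑)
  from : Gamma+⁺ N P ⊎ Gamma+⁺ N (suc P) → Gamma+ (suc N) (suc P)
  from (inj₁ (σ , σ↑))                = zero ∷ σ , σ↑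
  from (inj₂ (zero  ∷ σ , (() ∷ _)))
  from (inj₂ (suc i ∷ σ , (_ ∷ σ↑))) = suc i ∷ σ , σ↑
  to∘from : ∀ τ → to (from τ) ≡ τ
  to∘from (inj₁ _)                         = refl
  to∘from (inj₂ (zero  ∷ σ , (() ∷ _)))
  to∘from (inj₂ (suc i ∷ σ , (0<i ∷ σ↑))) =
    cong (λ r → inj₂ (suc i ∷ σ , r ∷ σ↑)) (<-irrelevant {suc N} {suc N} (s≤s z≤n) 0<i)
  from∘to : ∀ σ → from (to σ) ≡ σ
  from∘to (zero  ∷ σ , σ↑) = refl
  from∘to (suc i ∷ σ , σ↑) = refl

Gamma+-pascal : ∀ N P → Gamma+ (suc N) (suc P) ↔ (Gamma+ N P ⊎ Gamma+ N (suc P))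
Gamma+-pascal N P =
  ↔-trans (Gamma+-splitByHead N P) (Gamma+⁺↔Gamma+ N P ⊎-↔ Gamma+⁺↔Gamma+ N (suc P))

Gamma+↔Fin-C : ∀ N P → Gamma+ N P ↔ Fin (N C P)
Gamma+↔Fin-C N       zero    =
  mk↔ₛ′ (λ _ → zero) (λ _ → [] , []) (λ { zero → refl }) (λ { ([] , []) → refl })
Gamma+↔Fin-C zero    (suc P) = mk↔ₛ′ (λ { (() ∷ _ , _) }) (λ ()) (λ ()) (λ { (() ∷ _ , _) })
Gamma+↔Fin-C (suc N) (suc P) =
  subst (λ k → Gamma+ (suc N) (suc P) ↔ Fin k) (nCk+nC[k+1]≡[n+1]C[k+1] N P)
    (↔-trans (Gamma+-pascal N P)
             (↔-trans (Gamma+↔Fin-C N P ⊎-↔ Gamma+↔Fin-C N (suc P)) (↔-sym +↔⊎)))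

Cil2Simplices↔Fin-C∗C : ∀ N M → Cil2Simplices N M ↔ Fin (((N C_) ∗ (N C_)) M)
Cil2Simplices↔Fin-C∗C N M =
  antidiagonal↔ M (λ P Q → Gamma+ N P × Gamma+ N Q) (λ P Q → (N C P) * (N C Q))
    (λ P Q → ↔-trans (Gamma+↔Fin-C N P ×-↔ Gamma+↔Fin-C N Q) (↔-sym *↔×))

mainTheorem11 : (N M : ℕ) → Cil2Simplices N M ↔ Fin (cil2 N M)
mainTheorem11 N M =
  subst (λ k → Cil2Simplices N M ↔ Fin k) (sym (cil2≗C∗C N M)) (Cil2Simplices↔Fin-C∗C N M)
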